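{- For every integer $n\ge 2$, the complete graph $K_n$ is not strictly $n$-colorable.
   Context: Graphs are finite and simple. An integer partition $\lambda$ of a positive integer $k$ is a multiset of positive integers summing to $k$; $a*b$ denotes $b$ copies of $a$. A $k$-assignment $L$ of $G$ assigns to each vertex $v$ a set $L(v)$ of $k$ colors; $G$ is $L$-colorable if there is a proper coloring with each vertex $v$ receiving a color from $L(v)$. For $\lambda=\{k_1,\dots,k_t\}$, a $\lambda$-assignment of $G$ is a $k$-assignment $L$ such that $\bigcup_{v}L(v)$ can be partitioned into sets $C_1,\dots,C_t$ with $|L(v)\cap C_i|=k_i$ for every vertex $v$ and every $i$; $G$ is $\lambda$-choosable if $G$ is $L$-colorable for every $\lambda$-assignment $L$. (It is known that $G$ is $\{1*k\}$-choosable iff $G$ is $k$-colorable.) A graph $G$ is strictly $k$-colorable if $\{1*k\}$ is the only integer partition $\lambda$ of $k$ for which $G$ is $\lambda$-choosable, i.e. $G$ is $\{1*k\}$-choosable and not $\lambda$-choosable for any other partition $\lambda$ of $k$. -}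

module Defs where

open import Data.Nat using (ℕ; _≟_)
open import Data.Fin using (Fin)
import Data.Fin as F
open import Data.List using (List; length; filter; replicate; lookup)
open import Data.Nat.ListAction using (sum)
open import Data.List.Relation.Unary.All using (All)
open import Data.List.Relation.Unary.Unique.Propositional using (Unique)
open import Data.List.Membership.Propositional using (_∈_)
open import Data.List.Relation.Binary.Permutation.Propositional using (_↭_)
open import Data.Product using (Σ; _×_; ∃)
open import Relation.Binary.PropositionalEquality using (_≡_; _≢_; refl) renaming (sym to ≡-sym)
open import Relation.Nullary using (¬_)
open import Data.Nat using (_<_)
open import Level using (0ℓ)

record Graph (V : ℕ) : Set₁ where
  field
    Adj    : Fin V → Fin V → Set
    sym    : ∀ {u v} → Adj u v → Adj v u
    irrefl : ∀ {v} → ¬ Adj v v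

open Graph public

K : (n : ℕ) → Graph n
K n = record
  { Adj = λ u v → u ≢ v
  ; sym = λ p q → p (≡-sym q)
  ; irrefl = λ p → p refl
  }

Colour : Set
Colour = ℕ

-- An integer partition of k: a list (multiset, order irrelevant) of positive integers summing to k.
IsPartition : ℕ → List ℕ → Set
IsPartition k λs = All (0 <_) λs × sum λs ≡ k

ones : ℕ → List ℕ
ones k = replicate k 1

IsKSet : ℕ → List Colour → Set
IsKSet k C = Unique C × length C ≡ k

IsKAssignment : ∀ {V} → ℕ → (Fin V → List Colour) → Set
IsKAssignment {V} k L = ∀ (v : Fin V) → IsKSet k (L v)

countIn : ∀ {t} → (Colour → Fin t) → Fin t → List Colour → ℕ
countIn c i C = length (filter (λ x → c x F.≟ i) C)

-- L is a λ-assignment (λ = λs, with t = length λs parts): L is a k-assignment and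
-- the colours can be partitioned into classes C_1..C_t (given by a class map c)
-- with |L(v) ∩ C_i| = k_i for all v and i.
IsLambdaAssignment : ∀ {V} → ℕ → List ℕ → (Fin V → List Colour) → Set
IsLambdaAssignment {V} k λs L =
  IsKAssignment k L ×
  Σ (Colour → Fin (length λs)) (λ c →
    ∀ (v : Fin V) (i : Fin (length λs)) → countIn c i (L v) ≡ lookup λs i)

Colourable : ∀ {V} → Graph V → (Fin V → List Colour) → Set
Colourable {V} G L = Σ (Fin V → Colour) (λ f →
  (∀ v → f v ∈ L v) × (∀ u v → Adj G u v → f u ≢ f v))

LambdaChoosable : ∀ {V} → Graph V → ℕ → List ℕ → Set
LambdaChoosable {V} G k λs =
  ∀ (L : Fin V → List Colour) → IsLambdaAssignment k λs L → Colourable G L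

StrictlyColourable : ∀ {V} → Graph V → ℕ → Set
StrictlyColourable G k =
  LambdaChoosable G k (ones k) ×
  (∀ (λs : List ℕ) → IsPartition k λs → ¬ (λs ↭ ones k) → ¬ LambdaChoosable G k λs)

module Submission where

-- Every k-assignment of K_m with m ≤ k is colourable greedily: when a vertex is
-- coloured, fewer than k colours are taken, so its list of k distinct colours
-- still offers a free one. Hence K_n is λ-choosable for every partition λ of n,
-- in particular for λ = {n}, which differs from {1*n} as soon as n ≥ 2.

open import Defs
open import Data.Nat using (ℕ; zero; suc; _≤_; _<_; s≤s; z≤n; s≤s⁻¹; _≟_)
open import Data.Nat.Properties using (≤-refl; ≤-trans; <⇒≤; <-≤-trans; +-identityʳ)
open import Data.Fin using (Fin) renaming (zero to fzero; suc to fsuc)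
import Data.Vec.Functional as Vector
open import Data.List using (List; _∷_; [_]; length; filter; tabulate)
open import Data.List.Properties using (filter-notAll; length-tabulate; length-replicate)
open import Data.List.Relation.Unary.Any as Any using (here; there)
open import Data.List.Relation.Unary.All as All using ()
open import Data.List.Relation.Unary.AllPairs using (_∷_)
open import Data.List.Relation.Unary.Unique.Propositional using (Unique)
open import Data.List.Membership.Propositional using (_∈_; _∉_)
open import Data.List.Membership.Propositional.Properties using (∈-filter⁺; ∈-tabulate⁺)
open import Data.List.Relation.Binary.Permutation.Propositional using (_↭_)
open import Data.List.Relation.Binary.Permutation.Propositional.Properties using (↭-length)
open import Data.Product using (∃-syntax; _×_; _,_)
open import Relation.Nullary using (¬_; yes; no; ¬?)
open import Relation.Binary.Definitions using (DecidableEquality)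
open import Relation.Binary.PropositionalEquality using (_≢_; refl; cong; trans; subst; subst₂) renaming (sym to ≡-sym)

module _ {a} {A : Set a} (_≟ᴬ_ : DecidableEquality A) where
  open import Data.List.Membership.DecPropositional _≟ᴬ_ using (_∈?_)

  without : A → List A → List A
  without x = filter (λ y → ¬? (x ≟ᴬ y))

  without-shorter : ∀ {x ys} → x ∈ ys → length (without x ys) < length ys
  without-shorter {x} {ys} x∈ys =
    filter-notAll (λ y → ¬? (x ≟ᴬ y)) ys (Any.map (λ x≡y x≢y → x≢y x≡y) x∈ys)

  ∈-without : ∀ {x y ys} → y ∈ ys → x ≢ y → y ∈ without x ys
  ∈-without {x} = ∈-filter⁺ (λ y → ¬? (x ≟ᴬ y))

  unique-longer⇒∃∉ : ∀ {xs : List A} (ys : List A) →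
                     Unique xs → length ys < length xs → ∃[ x ] x ∈ xs × x ∉ ys
  unique-longer⇒∃∉ {x ∷ xs} ys (x∉xs ∷ xs-unique) |ys|<|x∷xs| with x ∈? ys
  ... | no x∉ys = x , here refl , x∉ys
  ... | yes x∈ys
    with y , y∈xs , y∉ys-x ← unique-longer⇒∃∉ (without x ys) xs-unique
                               (<-≤-trans (without-shorter x∈ys) (s≤s⁻¹ |ys|<|x∷xs|))
    = y , there y∈xs , λ y∈ys → y∉ys-x (∈-without y∈ys (All.lookup x∉xs y∈xs))

extend-colouring : ∀ {m k} → m < k → (L : Fin (suc m) → List Colour) → IsKSet k (L fzero) →
                   Colourable (K m) (λ v → L (fsuc v)) → Colourable (K (suc m)) L
extend-colouring m<k L (L₀-unique , |L₀|≡k) (f , f∈L , f-proper)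
  with c , c∈L₀ , c-unused ← unique-longer⇒∃∉ _≟_ (tabulate f) L₀-unique
                               (subst₂ _<_ (≡-sym (length-tabulate f)) (≡-sym |L₀|≡k) m<k)
  = c Vector.∷ f , c∷f∈L , c∷f-proper
  where
  c∷f∈L : ∀ v → (c Vector.∷ f) v ∈ L v
  c∷f∈L fzero    = c∈L₀
  c∷f∈L (fsuc v) = f∈L v

  c∷f-proper : ∀ u v → u ≢ v → (c Vector.∷ f) u ≢ (c Vector.∷ f) v
  c∷f-proper fzero    fzero    u≢v _  = u≢v refl
  c∷f-proper fzero    (fsuc v) _   eq = c-unused (subst (_∈ tabulate f) (≡-sym eq) (∈-tabulate⁺ v))
  c∷f-proper (fsuc u) fzero    _   eq = c-unused (subst (_∈ tabulate f) eq (∈-tabulate⁺ u))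
  c∷f-proper (fsuc u) (fsuc v) u≢v    = f-proper u v (λ u≡v → u≢v (cong fsuc u≡v))

K-choosable : ∀ {m k} → m ≤ k → (L : Fin m → List Colour) → IsKAssignment k L → Colourable (K m) L
K-choosable {zero}  _   L _       = (λ ()) , (λ ()) , (λ ())
K-choosable {suc m} m<k L L-kSets =
  extend-colouring m<k L (L-kSets fzero)
    (K-choosable (<⇒≤ m<k) (λ v → L (fsuc v)) (λ v → L-kSets (fsuc v)))

K-λ-choosable : ∀ n λs → LambdaChoosable (K n) n λs
K-λ-choosable n λs L (L-kAssignment , _) = K-choosable ≤-refl L L-kAssignment

singleton-isPartition : ∀ {k} → 0 < k → IsPartition k [ k ]
singleton-isPartition {k} 0<k = 0<k All.∷ All.[] , +-identityʳ k

singleton≁ones : ∀ {k} → 2 ≤ k → ¬ ([ k ] ↭ ones k)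
singleton≁ones {suc zero}    (s≤s ())
singleton≁ones {suc (suc k)} _ [k]↭ones
  with () ← trans (↭-length [k]↭ones) (length-replicate (suc (suc k)))

mainTheorem10 : (n : ℕ) → 2 ≤ n → ¬ StrictlyColourable (K n) n
mainTheorem10 n 2≤n (_ , onlyOnes) =
  onlyOnes [ n ] (singleton-isPartition (≤-trans (s≤s z≤n) 2≤n)) (singleton≁ones 2≤n)
           (K-λ-choosable n [ n ])
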